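{- For all $\phi,\chi\in\mathcal{L}_\blacktriangle$: if the sequent $\phi\vdash\chi$ is valid, then it is provable in $\mathbb{S}(\mathbf{K}^\blacktriangle_\mathbf{FDE})$, i.e., there is a closed tree whose initial node is $\{w_0:\phi;\mathfrak{t},\ w_0:\chi;\overline{\mathfrak{t}}\}$.
   Context: Semantics. Formulas of $\mathcal{L}_\blacktriangle$: $\phi::=p\mid\neg\phi\mid\phi\wedge\phi\mid\phi\vee\phi\mid\blacktriangle\phi$, $p$ in a countable set $\mathsf{Var}$. A frame is $\langle W,R\rangle$, $W\neq\varnothing$, $R\subseteq W^2$; a model is $\langle W,R,v^+,v^-\rangle$ with independent $v^+,v^-:\mathsf{Var}\to 2^W$. $w\vDash^+p$ iff $w\in v^+(p)$; $w\vDash^-p$ iff $w\in v^-(p)$; $\neg$ swaps $\vDash^+$ and $\vDash^-$; $\wedge$: true iff both true, false iff some false; $\vee$: true iff some true, false iff both false. $w_0\vDash^+\blacktriangle\phi$ iff for all $R$-successors $w_1,w_2$ of $w_0$, ($w_1\vDash^+\phi\Rightarrow w_2\vDash^+\phi$) and ($w_1\vDash^-\phi\Rightarrow w_2\vDash^-\phi$), and every $R$-successor $w_1$ has $w_1\vDash^+\phi$ or $w_1\vDash^-\phi$. $w_0\vDash^-\blacktriangle\phi$ iff there are successors $w_1,w_2$ of $w_0$ with ($w_1\vDash^+\phi$, $w_2\nvDash^+\phi$) or ($w_1\vDash^-\phi$, $w_2\nvDash^-\phi$) or ($w_1\vDash^+\phi$, $w_2\vDash^-\phi$). $\phi\vdash\chi$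 is valid iff in every model at every state, $\vDash^+\phi$ implies $\vDash^+\chi$. Calculus. Fix a countable set of state-labels and value-labels $\{\mathfrak{t},\mathfrak{f},\overline{\mathfrak{t}},\overline{\mathfrak{f}}\}$ (read: true, false, not-true, not-false). A labelled formula is $w:\phi;\mathfrak{v}$. Conventions: $\overline{\overline{\mathfrak{t}}}=\mathfrak{t}$, $\overline{\overline{\mathfrak{f}}}=\mathfrak{f}$; $\mathfrak{t}^\neg=\mathfrak{f}$, $\mathfrak{f}^\neg=\mathfrak{t}$, $\overline{\mathfrak{t}}^\neg=\overline{\mathfrak{f}}$, $\overline{\mathfrak{f}}^\neg=\overline{\mathfrak{t}}$; $w:\phi;\mathfrak{v}_1;\mathfrak{v}_2$ abbreviates $w:\phi;\mathfrak{v}_1$ and $w:\phi;\mathfrak{v}_2$. A proof is a downward-branching tree whose nodes are sets of labelled formulas and relational atoms $w\mathsf{R}w'$; a branch may be extended by the rules below (premises before $\Rightarrow$; $\{i,j\}=\{1,2\}$; $w_k,w_{k_1},w_{k_2}$ fresh on the branch): $\neg$: $w:\neg\phi;\mathfrak{t}\Rightarrow w:\phi;\mathfrak{f}$; $w:\neg\phi;\mathfrak{f}\Rightarrow w:\phi;\mathfrak{t}$; $w:\neg\phi;\overline{\mathfrak{t}}\Rightarrow w:\phi;\overline{\mathfrak{f}}$; $w:\neg\phi;\overline{\mathfrak{f}}\Rightarrow w:\phi;\overline{\mathfrak{t}}$. $\wedge$: $w:\phi_1\wedge\phi_2;\mathfrak{t}\Rightarrow w:\phi_1;\mathfrak{t}$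 and $w:\phi_2;\mathfrak{t}$; $w:\phi_1\wedge\phi_2;\mathfrak{f}$, $w:\phi_i;\overline{\mathfrak{f}}\Rightarrow w:\phi_j;\mathfrak{f}$; $w:\phi_1\wedge\phi_2;\overline{\mathfrak{t}}$, $w:\phi_i;\mathfrak{t}\Rightarrow w:\phi_j;\overline{\mathfrak{t}}$; $w:\phi_1\wedge\phi_2;\overline{\mathfrak{f}}\Rightarrow w:\phi_1;\overline{\mathfrak{f}}$ and $w:\phi_2;\overline{\mathfrak{f}}$. $\vee$: $w:\phi_1\vee\phi_2;\mathfrak{t}$, $w:\phi_i;\overline{\mathfrak{t}}\Rightarrow w:\phi_j;\mathfrak{t}$; $w:\phi_1\vee\phi_2;\mathfrak{f}\Rightarrow w:\phi_1;\mathfrak{f}$ and $w:\phi_2;\mathfrak{f}$; $w:\phi_1\vee\phi_2;\overline{\mathfrak{t}}\Rightarrow w:\phi_1;\overline{\mathfrak{t}}$ and $w:\phi_2;\overline{\mathfrak{t}}$; $w:\phi_1\vee\phi_2;\overline{\mathfrak{f}}$, $w:\phi_i;\mathfrak{f}\Rightarrow w:\phi_j;\overline{\mathfrak{f}}$. Cut: with no premises, split the branch into $w:\phi;\mathfrak{v}\mid w:\phi;\overline{\mathfrak{v}}$, provided $\phi$ is a subformula of a formula on the branch and $w$ occurs on the branch. $\blacktriangle_T$: $w_i:\blacktriangle\phi;\mathfrak{t};\overline{\mathfrak{f}}$, $w_i\mathsf{R}w_j$, $w_j:\phi;\mathfrak{v}\Rightarrow w_j:\phi;\overline{\mathfrak{v}}^\neg$.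 $\blacktriangle'_T$: $w_i:\blacktriangle\phi;\mathfrak{t};\overline{\mathfrak{f}}$, $w_i\mathsf{R}w_{j_1}$, $w_i\mathsf{R}w_{j_2}$, $w_{j_1}:\phi;\mathfrak{v};\overline{\mathfrak{v}}^\neg\Rightarrow w_{j_2}:\phi;\mathfrak{v};\overline{\mathfrak{v}}^\neg$. $\blacktriangle_F$: $w_i:\blacktriangle\phi;\mathfrak{f};\overline{\mathfrak{t}}\Rightarrow$ add $w_i\mathsf{R}w_{k_1}$, $w_i\mathsf{R}w_{k_2}$, then split into $\{w_{k_1}:\phi;\mathfrak{t},\ w_{k_2}:\phi;\overline{\mathfrak{t}}\}\mid\{w_{k_1}:\phi;\mathfrak{f},\ w_{k_2}:\phi;\overline{\mathfrak{f}}\}$. $\blacktriangle_B$: $w_i:\blacktriangle\phi;\mathfrak{t};\mathfrak{f}$, $w_i\mathsf{R}w_j\Rightarrow w_j:\phi;\mathfrak{t};\mathfrak{f}$. $\blacktriangle^+_B$: $w_i:\blacktriangle\phi;\mathfrak{t};\mathfrak{f}\Rightarrow w_i\mathsf{R}w_k$, $w_k:\phi;\mathfrak{t};\mathfrak{f}$. $\blacktriangle_N$: $w_i:\blacktriangle\phi;\overline{\mathfrak{t}};\overline{\mathfrak{f}}$, $w_i\mathsf{R}w_j\Rightarrow w_j:\phi;\overline{\mathfrak{t}};\overline{\mathfrak{f}}$. $\blacktriangle^+_N$: $w_i:\blacktriangle\phi;\overline{\mathfrak{t}};\overline{\mathfrak{f}}\Rightarrow w_i\mathsf{R}w_k$,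 $w_k:\phi;\overline{\mathfrak{t}};\overline{\mathfrak{f}}$. A branch is closed iff it contains $w:\phi;\mathfrak{v}$ and $w:\phi;\overline{\mathfrak{v}}$ for some $w,\phi,\mathfrak{v}$; a tree is closed iff all its branches are closed. -}

module Defs where

open import Data.Nat using (ℕ)
open import Data.List using (List; []; _∷_)
open import Data.List.Membership.Propositional using (_∈_)
open import Data.Product using (Σ; _×_; ∃; ∃-syntax)
open import Data.Sum using (_⊎_)
open import Relation.Nullary using (¬_)
open import Relation.Binary.PropositionalEquality using (_≡_; _≢_)

data Form : Set where
  var : ℕ → Form
  neg : Form → Form
  _∧'_ : Form → Form → Form
  _∨'_ : Form → Form → Form
  tri : Form → Form

data _≼_ : Form → Form → Set where
  ≼-refl : ∀ {φ} → φ ≼ φ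
  ≼-neg  : ∀ {φ ψ} → φ ≼ ψ → φ ≼ neg ψ
  ≼-∧₁   : ∀ {φ ψ₁ ψ₂} → φ ≼ ψ₁ → φ ≼ (ψ₁ ∧' ψ₂)
  ≼-∧₂   : ∀ {φ ψ₁ ψ₂} → φ ≼ ψ₂ → φ ≼ (ψ₁ ∧' ψ₂)
  ≼-∨₁   : ∀ {φ ψ₁ ψ₂} → φ ≼ ψ₁ → φ ≼ (ψ₁ ∨' ψ₂)
  ≼-∨₂   : ∀ {φ ψ₁ ψ₂} → φ ≼ ψ₂ → φ ≼ (ψ₁ ∨' ψ₂)
  ≼-tri  : ∀ {φ ψ} → φ ≼ ψ → φ ≼ tri ψ

-- Semantics (Belnap–Dunn style, independent positive/negative valuations)

record Model : Set₁ where
  field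
    W   : Set
    R   : W → W → Set
    v⁺  : ℕ → W → Set
    v⁻  : ℕ → W → Set
    inhabited : W

module Sem (M : Model) where
  open Model M

  mutual
    _⊨⁺_ : W → Form → Set
    w ⊨⁺ var p = v⁺ p w
    w ⊨⁺ neg φ = w ⊨⁻ φ
    w ⊨⁺ (φ ∧' ψ) = (w ⊨⁺ φ) × (w ⊨⁺ ψ)
    w ⊨⁺ (φ ∨' ψ) = (w ⊨⁺ φ) ⊎ (w ⊨⁺ ψ)
    w₀ ⊨⁺ tri φ =
      (∀ w₁ w₂ → R w₀ w₁ → R w₀ w₂ →
         ((w₁ ⊨⁺ φ → w₂ ⊨⁺ φ) × (w₁ ⊨⁻ φ → w₂ ⊨⁻ φ)))
      × (∀ w₁ → R w₀ w₁ → (w₁ ⊨⁺ φ) ⊎ (w₁ ⊨⁻ φ))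

    _⊨⁻_ : W → Form → Set
    w ⊨⁻ var p = v⁻ p w
    w ⊨⁻ neg φ = w ⊨⁺ φ
    w ⊨⁻ (φ ∧' ψ) = (w ⊨⁻ φ) ⊎ (w ⊨⁻ ψ)
    w ⊨⁻ (φ ∨' ψ) = (w ⊨⁻ φ) × (w ⊨⁻ ψ)
    w₀ ⊨⁻ tri φ =
      Σ W λ w₁ → Σ W λ w₂ → R w₀ w₁ × R w₀ w₂ ×
        (((w₁ ⊨⁺ φ) × ¬ (w₂ ⊨⁺ φ))
         ⊎ (((w₁ ⊨⁻ φ) × ¬ (w₂ ⊨⁻ φ))
         ⊎ ((w₁ ⊨⁺ φ) × (w₂ ⊨⁻ φ))))

Valid : Form → Form → Set₁
Valid φ χ = (M : Model) (w : Model.W M) →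
  Sem._⊨⁺_ M w φ → Sem._⊨⁺_ M w χ

-- value labels: t, f, t̄ (not-true), f̄ (not-false)
data Val : Set where
  𝔱 𝔣 𝔱̄ 𝔣̄ : Val

bar : Val → Val
bar 𝔱 = 𝔱̄
bar 𝔣 = 𝔣̄
bar 𝔱̄ = 𝔱
bar 𝔣̄ = 𝔣

negV : Val → Val
negV 𝔱 = 𝔣
negV 𝔣 = 𝔱
negV 𝔱̄ = 𝔣̄
negV 𝔣̄ = 𝔱̄

-- state labels are natural numbers; a node item is a labelled formula
-- w : φ ; v   or a relational atom  w R w'
data Item : Set where
  lf  : ℕ → Form → Val → Item
  rel : ℕ → ℕ → Item

Branch : Set
Branch = List Item

data LabelIn (w : ℕ) : Item → Set where
  in-lf   : ∀ {φ v} → LabelIn w (lf w φ v)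
  in-relˡ : ∀ {u} → LabelIn w (rel w u)
  in-relʳ : ∀ {u} → LabelIn w (rel u w)

Occurs : ℕ → Branch → Set
Occurs w Γ = Σ Item λ i → (i ∈ Γ) × LabelIn w i

Fresh : ℕ → Branch → Set
Fresh w Γ = ¬ Occurs w Γ

SubOn : Form → Branch → Set
SubOn φ Γ = Σ ℕ λ w → Σ Form λ ψ → Σ Val λ v → (lf w ψ v ∈ Γ) × (φ ≼ ψ)

-- {i,j} = {1,2}: (φi , φj) is (φ1 , φ2) or (φ2 , φ1)
data Pick (φ₁ φ₂ : Form) : Form → Form → Set where
  pick₁ : Pick φ₁ φ₂ φ₁ φ₂
  pick₂ : Pick φ₁ φ₂ φ₂ φ₁

-- Closes Γ : the branch Γ can be extended by the rules to a tree
-- all of whose branches are closed.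
data Closes (Γ : Branch) : Set where
  closed : ∀ {w φ v} → lf w φ v ∈ Γ → lf w φ (bar v) ∈ Γ → Closes Γ

  r-neg : ∀ {w φ v} → lf w (neg φ) v ∈ Γ →
    Closes (lf w φ (negV v) ∷ Γ) → Closes Γ

  r-∧𝔱 : ∀ {w φ₁ φ₂} → lf w (φ₁ ∧' φ₂) 𝔱 ∈ Γ →
    Closes (lf w φ₁ 𝔱 ∷ lf w φ₂ 𝔱 ∷ Γ) → Closes Γ
  r-∧𝔣 : ∀ {w φ₁ φ₂ φi φj} → Pick φ₁ φ₂ φi φj →
    lf w (φ₁ ∧' φ₂) 𝔣 ∈ Γ → lf w φi 𝔣̄ ∈ Γ →
    Closes (lf w φj 𝔣 ∷ Γ) → Closes Γ
  r-∧𝔱̄ : ∀ {w φ₁ φ₂ φi φj} → Pick φ₁ φ₂ φi φj →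
    lf w (φ₁ ∧' φ₂) 𝔱̄ ∈ Γ → lf w φi 𝔱 ∈ Γ →
    Closes (lf w φj 𝔱̄ ∷ Γ) → Closes Γ
  r-∧𝔣̄ : ∀ {w φ₁ φ₂} → lf w (φ₁ ∧' φ₂) 𝔣̄ ∈ Γ →
    Closes (lf w φ₁ 𝔣̄ ∷ lf w φ₂ 𝔣̄ ∷ Γ) → Closes Γ

  r-∨𝔱 : ∀ {w φ₁ φ₂ φi φj} → Pick φ₁ φ₂ φi φj →
    lf w (φ₁ ∨' φ₂) 𝔱 ∈ Γ → lf w φi 𝔱̄ ∈ Γ →
    Closes (lf w φj 𝔱 ∷ Γ) → Closes Γ
  r-∨𝔣 : ∀ {w φ₁ φ₂} → lf w (φ₁ ∨' φ₂) 𝔣 ∈ Γ →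
    Closes (lf w φ₁ 𝔣 ∷ lf w φ₂ 𝔣 ∷ Γ) → Closes Γ
  r-∨𝔱̄ : ∀ {w φ₁ φ₂} → lf w (φ₁ ∨' φ₂) 𝔱̄ ∈ Γ →
    Closes (lf w φ₁ 𝔱̄ ∷ lf w φ₂ 𝔱̄ ∷ Γ) → Closes Γ
  r-∨𝔣̄ : ∀ {w φ₁ φ₂ φi φj} → Pick φ₁ φ₂ φi φj →
    lf w (φ₁ ∨' φ₂) 𝔣̄ ∈ Γ → lf w φi 𝔣 ∈ Γ →
    Closes (lf w φj 𝔣̄ ∷ Γ) → Closes Γ

  cut : ∀ w φ v → SubOn φ Γ → Occurs w Γ →
    Closes (lf w φ v ∷ Γ) → Closes (lf w φ (bar v) ∷ Γ) → Closes Γ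

  r-▲T : ∀ {wi wj φ v} →
    lf wi (tri φ) 𝔱 ∈ Γ → lf wi (tri φ) 𝔣̄ ∈ Γ → rel wi wj ∈ Γ →
    lf wj φ v ∈ Γ →
    Closes (lf wj φ (negV (bar v)) ∷ Γ) → Closes Γ
  r-▲T′ : ∀ {wi wj₁ wj₂ φ v} →
    lf wi (tri φ) 𝔱 ∈ Γ → lf wi (tri φ) 𝔣̄ ∈ Γ →
    rel wi wj₁ ∈ Γ → rel wi wj₂ ∈ Γ →
    lf wj₁ φ v ∈ Γ → lf wj₁ φ (negV (bar v)) ∈ Γ →
    Closes (lf wj₂ φ v ∷ lf wj₂ φ (negV (bar v)) ∷ Γ) → Closes Γ
  r-▲F : ∀ {wi φ} k₁ k₂ →
    lf wi (tri φ) 𝔣 ∈ Γ → lf wi (tri φ) 𝔱̄ ∈ Γ →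
    Fresh k₁ Γ → Fresh k₂ Γ → k₁ ≢ k₂ →
    Closes (lf k₁ φ 𝔱 ∷ lf k₂ φ 𝔱̄ ∷ rel wi k₁ ∷ rel wi k₂ ∷ Γ) →
    Closes (lf k₁ φ 𝔣 ∷ lf k₂ φ 𝔣̄ ∷ rel wi k₁ ∷ rel wi k₂ ∷ Γ) →
    Closes Γ
  r-▲B : ∀ {wi wj φ} →
    lf wi (tri φ) 𝔱 ∈ Γ → lf wi (tri φ) 𝔣 ∈ Γ → rel wi wj ∈ Γ →
    Closes (lf wj φ 𝔱 ∷ lf wj φ 𝔣 ∷ Γ) → Closes Γ
  r-▲B⁺ : ∀ {wi φ} k →
    lf wi (tri φ) 𝔱 ∈ Γ → lf wi (tri φ) 𝔣 ∈ Γ → Fresh k Γ →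
    Closes (rel wi k ∷ lf k φ 𝔱 ∷ lf k φ 𝔣 ∷ Γ) → Closes Γ
  r-▲N : ∀ {wi wj φ} →
    lf wi (tri φ) 𝔱̄ ∈ Γ → lf wi (tri φ) 𝔣̄ ∈ Γ → rel wi wj ∈ Γ →
    Closes (lf wj φ 𝔱̄ ∷ lf wj φ 𝔣̄ ∷ Γ) → Closes Γ
  r-▲N⁺ : ∀ {wi φ} k →
    lf wi (tri φ) 𝔱̄ ∈ Γ → lf wi (tri φ) 𝔣̄ ∈ Γ → Fresh k Γ →
    Closes (rel wi k ∷ lf k φ 𝔱̄ ∷ lf k φ 𝔣̄ ∷ Γ) → Closes Γ

Provable : Form → Form → Set
Provable φ χ = Closes (lf 0 φ 𝔱 ∷ lf 0 χ 𝔱̄ ∷ [])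

{-# OPTIONS --safe #-}
-- Completeness via a canonical model read off a saturated branch.  Proof search from
-- the root branch cuts, at every label, every subformula of the input on 𝔱/𝔱̄ and on
-- 𝔣/𝔣̄, and, up to the modal depth of the input, applies ▲F, ▲B⁺ or ▲N⁺ so that every
-- ▲-subformula has witnessing successors.  The labels so created form a tree; on an open
-- leaf without a clash it is a Kripke model whose valuations are the atoms labelled 𝔱
-- and 𝔣.  The truth lemma (by induction on formulas) says that a world verifies
-- (falsifies) a subformula iff the leaf labels it 𝔱 (𝔣), unless one more rule
-- application closes the leaf; constructively it is stated as "the leaf closes or the
-- truth lemma holds".  The root then satisfies the initial labelled formulas, which is
-- impossible when they are unsatisfiable, so every leaf closes.
module Submission where

open import Defs
open import Level using (0ℓ)
open import Function using (id; _∘_; const; _⇔_; mk⇔; Equivalence)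
open import Function.Properties.Equivalence using () renaming (refl to ⇔-refl; trans to ⇔-trans)
open import Data.Product.Function.NonDependent.Propositional using (_×-⇔_)
open import Data.Sum.Function.Propositional using (_⊎-⇔_)
open import Data.Nat using (ℕ; suc; _≤_; _⊔_; s≤s)
import Data.Nat.Properties as ℕ
open import Data.List using (List; []; _∷_; _++_; map; concatMap)
open import Data.List.Extrema.Nat using (max; xs≤max)
open import Data.List.Membership.Propositional using (_∈_; find; lose)
open import Data.List.Membership.Propositional.Properties using (∈-++⁺ˡ; ∈-++⁺ʳ; ∈-++⁻; ∈-map⁺; ∈-map⁻; ∈-concatMap⁺; ∈-concatMap⁻)
open import Data.List.Relation.Binary.Subset.Propositional using (_⊆_)
open import Data.List.Relation.Binary.Subset.Propositional.Properties using (⊆-refl; ⊆-trans; xs⊆xs++ys; xs⊆ys++xs)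
open import Data.List.Relation.Unary.Any as Any using (Any; here; there; any?)
open import Data.List.Relation.Unary.All as All using (All; []; _∷_)
import Data.List.Relation.Unary.All.Properties as All
import Data.Sum.Effectful.Left as SumLeft
open import Data.Product using (∃; _×_; _,_; proj₁; proj₂; uncurry)
import Data.Product as Product
open import Data.Sum using (_⊎_; inj₁; inj₂; [_,_]′)
import Data.Sum as Sum
open import Data.Empty using (⊥; ⊥-elim)
open import Effect.Monad using (RawMonad)
open import Relation.Nullary using (¬_; yes; no)
open import Relation.Nullary.Decidable using (map′; _×-dec_)
open import Relation.Unary using (Decidable)
open import Relation.Binary.Definitions using (DecidableEquality)
open import Relation.Binary.PropositionalEquality using (_≡_; refl; sym; cong; subst)

_≟ᶠ_ : DecidableEquality Form
var p ≟ᶠ var q = map′ (cong var) (λ { refl → refl }) (p ℕ.≟ q)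
neg a ≟ᶠ neg b = map′ (cong neg) (λ { refl → refl }) (a ≟ᶠ b)
(a ∧' b) ≟ᶠ (c ∧' d) = map′ (λ { (refl , refl) → refl }) (λ { refl → refl , refl }) (a ≟ᶠ c ×-dec b ≟ᶠ d)
(a ∨' b) ≟ᶠ (c ∨' d) = map′ (λ { (refl , refl) → refl }) (λ { refl → refl , refl }) (a ≟ᶠ c ×-dec b ≟ᶠ d)
tri a ≟ᶠ tri b = map′ (cong tri) (λ { refl → refl }) (a ≟ᶠ b)
var _ ≟ᶠ neg _ = no λ ()
var _ ≟ᶠ (_ ∧' _) = no λ ()
var _ ≟ᶠ (_ ∨' _) = no λ ()
var _ ≟ᶠ tri _ = no λ ()
neg _ ≟ᶠ var _ = no λ ()
neg _ ≟ᶠ (_ ∧' _) = no λ ()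
neg _ ≟ᶠ (_ ∨' _) = no λ ()
neg _ ≟ᶠ tri _ = no λ ()
(_ ∧' _) ≟ᶠ var _ = no λ ()
(_ ∧' _) ≟ᶠ neg _ = no λ ()
(_ ∧' _) ≟ᶠ (_ ∨' _) = no λ ()
(_ ∧' _) ≟ᶠ tri _ = no λ ()
(_ ∨' _) ≟ᶠ var _ = no λ ()
(_ ∨' _) ≟ᶠ neg _ = no λ ()
(_ ∨' _) ≟ᶠ (_ ∧' _) = no λ ()
(_ ∨' _) ≟ᶠ tri _ = no λ ()
tri _ ≟ᶠ var _ = no λ ()
tri _ ≟ᶠ neg _ = no λ ()
tri _ ≟ᶠ (_ ∧' _) = no λ ()
tri _ ≟ᶠ (_ ∨' _) = no λ ()

_≟ᵛ_ : DecidableEquality Val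
𝔱 ≟ᵛ 𝔱 = yes refl
𝔣 ≟ᵛ 𝔣 = yes refl
𝔱̄ ≟ᵛ 𝔱̄ = yes refl
𝔣̄ ≟ᵛ 𝔣̄ = yes refl
𝔱 ≟ᵛ 𝔣 = no λ ()
𝔱 ≟ᵛ 𝔱̄ = no λ ()
𝔱 ≟ᵛ 𝔣̄ = no λ ()
𝔣 ≟ᵛ 𝔱 = no λ ()
𝔣 ≟ᵛ 𝔱̄ = no λ ()
𝔣 ≟ᵛ 𝔣̄ = no λ ()
𝔱̄ ≟ᵛ 𝔱 = no λ ()
𝔱̄ ≟ᵛ 𝔣 = no λ ()
𝔱̄ ≟ᵛ 𝔣̄ = no λ ()
𝔣̄ ≟ᵛ 𝔱 = no λ ()
𝔣̄ ≟ᵛ 𝔣 = no λ ()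
𝔣̄ ≟ᵛ 𝔱̄ = no λ ()

_≟ⁱ_ : DecidableEquality Item
lf w φ v ≟ⁱ lf w′ φ′ v′ =
  map′ (λ { (refl , refl , refl) → refl }) (λ { refl → refl , refl , refl })
       (w ℕ.≟ w′ ×-dec φ ≟ᶠ φ′ ×-dec v ≟ᵛ v′)
rel u w ≟ⁱ rel u′ w′ = map′ (λ { (refl , refl) → refl }) (λ { refl → refl , refl }) (u ℕ.≟ u′ ×-dec w ℕ.≟ w′)
lf _ _ _ ≟ⁱ rel _ _ = no λ ()
rel _ _ ≟ⁱ lf _ _ _ = no λ ()

open import Data.List.Membership.DecPropositional _≟ⁱ_ using (_∈?_)

≼-trans : ∀ {ψ φ θ} → ψ ≼ φ → φ ≼ θ → ψ ≼ θ
≼-trans p ≼-refl = p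
≼-trans p (≼-neg q) = ≼-neg (≼-trans p q)
≼-trans p (≼-∧₁ q) = ≼-∧₁ (≼-trans p q)
≼-trans p (≼-∧₂ q) = ≼-∧₂ (≼-trans p q)
≼-trans p (≼-∨₁ q) = ≼-∨₁ (≼-trans p q)
≼-trans p (≼-∨₂ q) = ≼-∨₂ (≼-trans p q)
≼-trans p (≼-tri q) = ≼-tri (≼-trans p q)

mutual
  subformulas : Form → List Form
  subformulas φ = φ ∷ properSubformulas φ

  properSubformulas : Form → List Form
  properSubformulas (var _) = []
  properSubformulas (neg a) = subformulas a
  properSubformulas (a ∧' b) = subformulas a ++ subformulas b
  properSubformulas (a ∨' b) = subformulas a ++ subformulas b
  properSubformulas (tri a) = subformulas a

∈-subformulas⁺ : ∀ {ψ θ} → ψ ≼ θ → ψ ∈ subformulas θ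
∈-subformulas⁺ ≼-refl = here refl
∈-subformulas⁺ (≼-neg p) = there (∈-subformulas⁺ p)
∈-subformulas⁺ (≼-∧₁ p) = there (∈-++⁺ˡ (∈-subformulas⁺ p))
∈-subformulas⁺ {θ = a ∧' _} (≼-∧₂ p) = there (∈-++⁺ʳ (subformulas a) (∈-subformulas⁺ p))
∈-subformulas⁺ (≼-∨₁ p) = there (∈-++⁺ˡ (∈-subformulas⁺ p))
∈-subformulas⁺ {θ = a ∨' _} (≼-∨₂ p) = there (∈-++⁺ʳ (subformulas a) (∈-subformulas⁺ p))
∈-subformulas⁺ (≼-tri p) = there (∈-subformulas⁺ p)

∈-subformulas⁻ : ∀ {ψ} θ → ψ ∈ subformulas θ → ψ ≼ θ
∈-subformulas⁻ θ (here refl) = ≼-refl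
∈-subformulas⁻ (neg a) (there m) = ≼-neg (∈-subformulas⁻ a m)
∈-subformulas⁻ (a ∧' b) (there m) =
  Sum.[ ≼-∧₁ ∘ ∈-subformulas⁻ a , ≼-∧₂ ∘ ∈-subformulas⁻ b ] (∈-++⁻ (subformulas a) m)
∈-subformulas⁻ (a ∨' b) (there m) =
  Sum.[ ≼-∨₁ ∘ ∈-subformulas⁻ a , ≼-∨₂ ∘ ∈-subformulas⁻ b ] (∈-++⁻ (subformulas a) m)
∈-subformulas⁻ (tri a) (there m) = ≼-tri (∈-subformulas⁻ a m)

modalDepth : Form → ℕ
modalDepth (var _) = 0
modalDepth (neg a) = modalDepth a
modalDepth (a ∧' b) = modalDepth a ⊔ modalDepth b
modalDepth (a ∨' b) = modalDepth a ⊔ modalDepth b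
modalDepth (tri a) = suc (modalDepth a)

labels : Item → List ℕ
labels (lf w _ _) = w ∷ []
labels (rel w w′) = w ∷ w′ ∷ []

∈-labels : ∀ {w i} → LabelIn w i → w ∈ labels i
∈-labels in-lf = here refl
∈-labels in-relˡ = here refl
∈-labels in-relʳ = there (here refl)

nextLabel : Branch → ℕ
nextLabel Γ = suc (max 0 (concatMap labels Γ))

fresh : ∀ {Γ k} → nextLabel Γ ≤ k → Fresh k Γ
fresh {Γ} h (_ , i∈Γ , w∈i) =
  ℕ.<⇒≱ h (All.lookup (xs≤max 0 (concatMap labels Γ)) (∈-concatMap⁺ labels (lose i∈Γ (∈-labels w∈i))))

Monotone : (Branch → Set) → Set
Monotone P = ∀ {Γ Δ} → Γ ⊆ Δ → P Γ → P Δ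

-- Γ ⇝ P : the rules grow Γ into a tree every open leaf Δ of which satisfies P,
-- so Γ closes as soon as every such Δ does.
infix 4 _⇝_
_⇝_ : Branch → (Branch → Set) → Set
Γ ⇝ P = (∀ {Δ} → Γ ⊆ Δ → P Δ → Closes Δ) → Closes Γ

module ⇝-Monad where

  pure : ∀ {Γ P} → P Γ → Γ ⇝ P
  pure p k = k ⊆-refl p

  _>>=_ : ∀ {Γ P Q} → Γ ⇝ P → (∀ {Δ} → Γ ⊆ Δ × P Δ → Δ ⇝ Q) → Γ ⇝ Q
  (m >>= f) k = m λ s p → f (s , p) λ s′ q → k (⊆-trans s s′) q

Settled : ℕ → Form → Val → Branch → Set
Settled u ψ v Γ = lf u ψ v ∈ Γ ⊎ lf u ψ (bar v) ∈ Γ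

Decided : ℕ → Form → Branch → Set
Decided u ψ Γ = Settled u ψ 𝔱 Γ × Settled u ψ 𝔣 Γ

Settled-mono : ∀ {u ψ v} → Monotone (Settled u ψ v)
Settled-mono s = Sum.map s s

Decided-mono : ∀ {u ψ} → Monotone (Decided u ψ)
Decided-mono s = Product.map (Settled-mono s) (Settled-mono s)

Occurs-mono : ∀ {u} → Monotone (Occurs u)
Occurs-mono s (i , i∈ , u∈i) = i , s i∈ , u∈i

SubOn-mono : ∀ {ψ} → Monotone (SubOn ψ)
SubOn-mono s (w , θ , v , θ∈ , ψ≼θ) = w , θ , v , s θ∈ , ψ≼θ

Varying : ℕ → ℕ → Form → Branch → Set
Varying k₁ k₂ a Γ = (lf k₁ a 𝔱 ∈ Γ × lf k₂ a 𝔱̄ ∈ Γ) ⊎ (lf k₁ a 𝔣 ∈ Γ × lf k₂ a 𝔣̄ ∈ Γ)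

-- ▲B and ▲N act on every successor, so for them it suffices that one exists.
data ▲Witness (u : ℕ) (ks : List ℕ) (a : Form) (Γ : Branch) : Set where
  ▲T : lf u (tri a) 𝔱 ∈ Γ → lf u (tri a) 𝔣̄ ∈ Γ → ▲Witness u ks a Γ
  ▲B : lf u (tri a) 𝔱 ∈ Γ → lf u (tri a) 𝔣 ∈ Γ → ∀ {k} → k ∈ ks → ▲Witness u ks a Γ
  ▲F : lf u (tri a) 𝔱̄ ∈ Γ → lf u (tri a) 𝔣 ∈ Γ → ∀ {k₁ k₂} → k₁ ∈ ks → k₂ ∈ ks →
       Varying k₁ k₂ a Γ → ▲Witness u ks a Γ
  ▲N : lf u (tri a) 𝔱̄ ∈ Γ → lf u (tri a) 𝔣̄ ∈ Γ → ∀ {k} → k ∈ ks → ▲Witness u ks a Γ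

▲Witness-mono : ∀ {u ks ks′ a Γ Δ} → Γ ⊆ Δ → ks ⊆ ks′ → ▲Witness u ks a Γ → ▲Witness u ks′ a Δ
▲Witness-mono s r (▲T t f̄) = ▲T (s t) (s f̄)
▲Witness-mono s r (▲B t f k∈) = ▲B (s t) (s f) (r k∈)
▲Witness-mono s r (▲F t̄ f k₁∈ k₂∈ d) =
  ▲F (s t̄) (s f) (r k₁∈) (r k₂∈) (Sum.map (Product.map s s) (Product.map s s) d)
▲Witness-mono s r (▲N t̄ f̄ k∈) = ▲N (s t̄) (s f̄) (r k∈)

Witness : ℕ → List ℕ → Form → Branch → Set
Witness u ks ψ Γ = ∀ {a} → ψ ≡ tri a → ▲Witness u ks a Γ

Witness-mono : ∀ {u ks ks′ ψ Γ Δ} → Γ ⊆ Δ → ks ⊆ ks′ → Witness u ks ψ Γ → Witness u ks′ ψ Δ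
Witness-mono s r w eq = ▲Witness-mono s r (w eq)

Expansion : ℕ → Form → Branch → Set
Expansion u ψ Δ = ∃ λ ks → All (λ k → rel u k ∈ Δ) ks × Witness u ks ψ Δ

module _ where
  open ⇝-Monad

  ⇝-all : ∀ {Γ} {A : Set} {P : A → Branch → Set} (xs : List A) → (∀ {x} → Monotone (P x)) →
          (∀ {x} → x ∈ xs → ∀ {Δ} → Γ ⊆ Δ → Δ ⇝ P x) → Γ ⇝ λ Δ → All (λ x → P x Δ) xs
  ⇝-all [] _ _ = pure []
  ⇝-all (x ∷ xs) mono step = do
    (s , p) ← step (here refl) ⊆-refl
    (s′ , ps) ← ⇝-all xs mono λ x∈ s″ → step (there x∈) (⊆-trans s s″)
    pure (mono s′ p ∷ ps)

  cut⇝ : ∀ {Γ u ψ} v → SubOn ψ Γ → Occurs u Γ → Γ ⇝ Settled u ψ v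
  cut⇝ {u = u} {ψ} v sub oc k = cut u ψ v sub oc (k there (inj₁ (here refl))) (k there (inj₂ (here refl)))

  decide⇝ : ∀ {Γ u ψ} → SubOn ψ Γ → Occurs u Γ → Γ ⇝ Decided u ψ
  decide⇝ sub oc = do
    (s , t) ← cut⇝ 𝔱 sub oc
    (s′ , f) ← cut⇝ 𝔣 (SubOn-mono s sub) (Occurs-mono s oc)
    pure (Settled-mono s′ t , f)

  successor⇝ : ∀ {Γ u a v v′} →
    (∀ k → Fresh k Γ → Closes (rel u k ∷ lf k a v ∷ lf k a v′ ∷ Γ) → Closes Γ) →
    Γ ⇝ λ Δ → ∃ λ k → rel u k ∈ Δ
  successor⇝ rule k = rule _ (fresh ℕ.≤-refl) (k (there ∘ there ∘ there) (_ , here refl))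

  ▲F⇝ : ∀ {Γ u a} → lf u (tri a) 𝔣 ∈ Γ → lf u (tri a) 𝔱̄ ∈ Γ →
    Γ ⇝ λ Δ → ∃ λ k₁ → ∃ λ k₂ → rel u k₁ ∈ Δ × rel u k₂ ∈ Δ × Varying k₁ k₂ a Δ
  ▲F⇝ {Γ} {u} f t̄ k =
    r-▲F k₁ k₂ f t̄ (fresh ℕ.≤-refl) (fresh (ℕ.n≤1+n _)) (ℕ.1+n≢n ∘ sym)
      (k extend (k₁ , k₂ , e₁ , e₂ , inj₁ (here refl , there (here refl))))
      (k extend (k₁ , k₂ , e₁ , e₂ , inj₂ (here refl , there (here refl))))
    where
      k₁ = nextLabel Γ
      k₂ = suc k₁
      extend : ∀ {i j} → Γ ⊆ i ∷ j ∷ rel u k₁ ∷ rel u k₂ ∷ Γ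
      extend = there ∘ there ∘ there ∘ there
      e₁ : ∀ {i j} → rel u k₁ ∈ i ∷ j ∷ rel u k₁ ∷ rel u k₂ ∷ Γ
      e₁ = there (there (here refl))
      e₂ : ∀ {i j} → rel u k₂ ∈ i ∷ j ∷ rel u k₁ ∷ rel u k₂ ∷ Γ
      e₂ = there (there (there (here refl)))

  ▲-expand : ∀ {Γ u a} → Decided u (tri a) Γ → Γ ⇝ Expansion u (tri a)
  ▲-expand (inj₁ t , inj₂ f̄) = pure ([] , [] , λ { refl → ▲T t f̄ })
  ▲-expand (inj₁ t , inj₁ f) = do
    (s , k , e) ← successor⇝ λ k → r-▲B⁺ k t f
    pure (k ∷ [] , e ∷ [] , λ { refl → ▲B (s t) (s f) (here refl) })
  ▲-expand (inj₂ t̄ , inj₁ f) = do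
    (s , k₁ , k₂ , e₁ , e₂ , d) ← ▲F⇝ f t̄
    pure (k₁ ∷ k₂ ∷ [] , e₁ ∷ e₂ ∷ [] , λ { refl → ▲F (s t̄) (s f) (here refl) (there (here refl)) d })
  ▲-expand (inj₂ t̄ , inj₂ f̄) = do
    (s , k , e) ← successor⇝ λ k → r-▲N⁺ k t̄ f̄
    pure (k ∷ [] , e ∷ [] , λ { refl → ▲N (s t̄) (s f̄) (here refl) })

  expand : ∀ {Γ u} ψ → Decided u ψ Γ → Γ ⇝ Expansion u ψ
  expand (tri a) d = ▲-expand d
  expand (var _) _ = pure ([] , [] , λ ())
  expand (neg _) _ = pure ([] , [] , λ ())
  expand (_ ∧' _) _ = pure ([] , [] , λ ())
  expand (_ ∨' _) _ = pure ([] , [] , λ ())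

  expandAll : ∀ {Γ u} ψs → All (λ ψ → Decided u ψ Γ) ψs →
    Γ ⇝ λ Δ → ∃ λ ks → All (λ k → rel u k ∈ Δ) ks × All (λ ψ → Witness u ks ψ Δ) ψs
  expandAll [] [] = pure ([] , [] , [])
  expandAll (ψ ∷ ψs) (d ∷ ds) = do
    (s , ks , es , ws) ← expandAll ψs ds
    (s′ , ks′ , es′ , w) ← expand ψ (Decided-mono s d)
    pure ( ks′ ++ ks
         , All.++⁺ es′ (All.map s′ es)
         , Witness-mono ⊆-refl (xs⊆xs++ys ks′ ks) w ∷ All.map (Witness-mono s′ (xs⊆ys++xs ks ks′)) ws )

NoClash : Branch → Set
NoClash Γ = ∀ {w ψ v} → lf w ψ v ∈ Γ → lf w ψ (bar v) ∈ Γ → ⊥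

Clashing : Branch → Item → Set
Clashing Γ (lf w ψ v) = lf w ψ (bar v) ∈ Γ
Clashing Γ (rel _ _) = ⊥

clashing? : ∀ Γ → Decidable (Clashing Γ)
clashing? Γ (lf w ψ v) = lf w ψ (bar v) ∈? Γ
clashing? Γ (rel _ _) = no λ ()

clash? : ∀ Γ → Closes Γ ⊎ NoClash Γ
clash? Γ with any? (clashing? Γ) Γ
... | yes c = inj₁ (close (find c))
  where
    close : ∃ (λ i → i ∈ Γ × Clashing Γ i) → Closes Γ
    close (lf _ _ _ , m , m̄) = closed m m̄
... | no ¬c = inj₂ λ m m̄ → ¬c (lose {P = Clashing Γ} m m̄)

module Signed (M : Model) where
  open Model M
  open Sem M

  _⊨_∶_ : W → Form → Val → Set
  w ⊨ ψ ∶ 𝔱 = w ⊨⁺ ψ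
  w ⊨ ψ ∶ 𝔣 = w ⊨⁻ ψ
  w ⊨ ψ ∶ 𝔱̄ = ¬ w ⊨⁺ ψ
  w ⊨ ψ ∶ 𝔣̄ = ¬ w ⊨⁻ ψ

  ▲-constant : ∀ {w a} →
    (∀ {w′} → R w w′ → w′ ⊨ a ∶ 𝔱 × w′ ⊨ a ∶ 𝔣̄) ⊎ (∀ {w′} → R w w′ → w′ ⊨ a ∶ 𝔱̄ × w′ ⊨ a ∶ 𝔣) →
    w ⊨ tri a ∶ 𝔱 × w ⊨ tri a ∶ 𝔣̄
  ▲-constant (inj₁ all) =
    ( ((λ _ _ r₁ r₂ → const (proj₁ (all r₂)) , ⊥-elim ∘ proj₂ (all r₁)) , λ _ r → inj₁ (proj₁ (all r)))
    , λ { (_ , _ , _ , r₂ , inj₁ (_ , ¬p)) → ¬p (proj₁ (all r₂))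
        ; (_ , _ , r₁ , _ , inj₂ (inj₁ (n , _))) → proj₂ (all r₁) n
        ; (_ , _ , _ , r₂ , inj₂ (inj₂ (_ , n))) → proj₂ (all r₂) n } )
  ▲-constant (inj₂ all) =
    ( ((λ _ _ r₁ r₂ → ⊥-elim ∘ proj₁ (all r₁) , const (proj₂ (all r₂))) , λ _ r → inj₂ (proj₂ (all r)))
    , λ { (_ , _ , r₁ , _ , inj₁ (p , _)) → proj₁ (all r₁) p
        ; (_ , _ , _ , r₂ , inj₂ (inj₁ (_ , ¬n))) → ¬n (proj₂ (all r₂))
        ; (_ , _ , r₁ , _ , inj₂ (inj₂ (p , _))) → proj₁ (all r₁) p } )

  ▲-glutty : ∀ {w a} → (∀ {w′} → R w w′ → w′ ⊨ a ∶ 𝔱 × w′ ⊨ a ∶ 𝔣) → ∃ (R w) →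
    w ⊨ tri a ∶ 𝔱 × w ⊨ tri a ∶ 𝔣
  ▲-glutty all (w′ , r) =
    ( ((λ _ _ _ r₂ → const (proj₁ (all r₂)) , const (proj₂ (all r₂))) , λ _ r₁ → inj₁ (proj₁ (all r₁)))
    , w′ , w′ , r , r , inj₂ (inj₂ (all r)) )

  ▲-gappy : ∀ {w a} → (∀ {w′} → R w w′ → w′ ⊨ a ∶ 𝔱̄ × w′ ⊨ a ∶ 𝔣̄) → ∃ (R w) →
    w ⊨ tri a ∶ 𝔱̄ × w ⊨ tri a ∶ 𝔣̄
  ▲-gappy all (w′ , r) =
    ( (λ (_ , total) → [ proj₁ (all r) , proj₂ (all r) ]′ (total w′ r))
    , λ { (_ , _ , r₁ , _ , inj₁ (p , _)) → proj₁ (all r₁) p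
        ; (_ , _ , r₁ , _ , inj₂ (inj₁ (n , _))) → proj₂ (all r₁) n
        ; (_ , _ , r₁ , _ , inj₂ (inj₂ (p , _))) → proj₁ (all r₁) p } )

  ▲-varying : ∀ {w w₁ w₂ a} → R w w₁ → R w w₂ →
    (w₁ ⊨ a ∶ 𝔱 × w₂ ⊨ a ∶ 𝔱̄) ⊎ (w₁ ⊨ a ∶ 𝔣 × w₂ ⊨ a ∶ 𝔣̄) →
    w ⊨ tri a ∶ 𝔱̄ × w ⊨ tri a ∶ 𝔣
  ▲-varying {w₁ = w₁} {w₂} r₁ r₂ (inj₁ (p , ¬p)) =
    (λ (agree , _) → ¬p (proj₁ (agree w₁ w₂ r₁ r₂) p)) , w₁ , w₂ , r₁ , r₂ , inj₁ (p , ¬p)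
  ▲-varying {w₁ = w₁} {w₂} r₁ r₂ (inj₂ (n , ¬n)) =
    (λ (agree , _) → ¬n (proj₂ (agree w₁ w₂ r₁ r₂) n)) , w₁ , w₂ , r₁ , r₂ , inj₂ (inj₁ (n , ¬n))

data LabelTree : Set where
  node : ℕ → List LabelTree → LabelTree

label : LabelTree → ℕ
label (node u _) = u

children : LabelTree → List LabelTree
children (node _ cs) = cs

sequence⊎ : ∀ {C A : Set} {P : A → Set} {xs} → All (λ x → C ⊎ P x) xs → C ⊎ All P xs
sequence⊎ {C} = All.sequenceM 0ℓ (SumLeft.monad C 0ℓ)

uniform : ∀ {A C : Set} {P Q : A → Set} {xs} → All (λ x → P x ⊎ Q x) xs →
  (∀ {x y} → x ∈ xs → y ∈ xs → P x → Q y → C) → C ⊎ (All P xs ⊎ All Q xs)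
uniform [] _ = inj₂ (inj₁ [])
uniform pqs@(inj₁ p ∷ _) conflict = Sum.map₂ inj₁ (sequence⊎ (All.tabulate λ y∈ →
  [ inj₂ , inj₁ ∘ conflict (here refl) y∈ p ]′ (All.lookup pqs y∈)))
uniform pqs@(inj₂ q ∷ _) conflict = Sum.map₂ inj₂ (sequence⊎ (All.tabulate λ y∈ →
  [ (λ p → inj₁ (conflict y∈ (here refl) p q)) , inj₂ ]′ (All.lookup pqs y∈)))

module Consistent {Γ : Branch} (consistent : NoClash Γ) where

  ClosesOr : Set → Set
  ClosesOr A = Closes Γ ⊎ A

  open RawMonad (SumLeft.monad (Closes Γ) 0ℓ) public using (pure; _>>=_)

  On : ℕ → Form → Val → Set
  On u ψ v = lf u ψ v ∈ Γ

  absent : ∀ {u ψ v} → On u ψ (bar v) → ¬ On u ψ v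
  absent m̄ m = consistent m m̄

  settle : ∀ {P : Set} {u ψ v} → (P × On u ψ v) ⊎ (¬ P × On u ψ (bar v)) → P ⇔ On u ψ v
  settle (inj₁ (p , m)) = mk⇔ (const m) (const p)
  settle (inj₂ (¬p , m̄)) = mk⇔ (⊥-elim ∘ ¬p) (⊥-elim ∘ absent m̄)

  forced : ∀ {u ψ v} → (Closes (lf u ψ v ∷ Γ) → Closes Γ) → Settled u ψ v Γ → ClosesOr (On u ψ v)
  forced rule (inj₁ m) = inj₂ m
  forced rule (inj₂ m̄) = inj₁ (rule (closed (here refl) (there m̄)))

  forced₂ : ∀ {u u′ ψ ψ′ v v′} → (Closes (lf u ψ v ∷ lf u′ ψ′ v′ ∷ Γ) → Closes Γ) →
    Settled u ψ v Γ → Settled u′ ψ′ v′ Γ → ClosesOr (On u ψ v × On u′ ψ′ v′)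
  forced₂ rule (inj₁ m) (inj₁ m′) = inj₂ (m , m′)
  forced₂ rule (inj₂ m̄) _ = inj₁ (rule (closed (here refl) (there (there m̄))))
  forced₂ rule (inj₁ _) (inj₂ m̄′) = inj₁ (rule (closed (there (here refl)) (there (there m̄′))))

  forced-⇔ : ∀ {u a c v w} →
    (On u c v → Closes (lf u a w ∷ Γ) → Closes Γ) →
    (On u c (bar v) → Closes (lf u a (bar w) ∷ Γ) → Closes Γ) →
    Settled u c v Γ → Settled u a w Γ → ClosesOr (On u a w ⇔ On u c v)
  forced-⇔ r r̄ (inj₁ c) (inj₁ a) = inj₂ (settle (inj₁ (a , c)))
  forced-⇔ r r̄ (inj₁ c) (inj₂ ā) = inj₁ (r c (closed (here refl) (there ā)))
  forced-⇔ r r̄ (inj₂ c̄) (inj₁ a) = inj₁ (r̄ c̄ (closed (there a) (here refl)))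
  forced-⇔ r r̄ (inj₂ c̄) (inj₂ ā) = inj₂ (settle (inj₂ (absent ā , c̄)))

  forced-× : ∀ {u a b c v} →
    (On u c v → Closes (lf u a v ∷ lf u b v ∷ Γ) → Closes Γ) →
    (On u c (bar v) → On u a v → Closes (lf u b (bar v) ∷ Γ) → Closes Γ) →
    Settled u c v Γ → Settled u a v Γ → Settled u b v Γ → ClosesOr ((On u a v × On u b v) ⇔ On u c v)
  forced-× split join (inj₁ c) sa sb = Sum.map₂ (λ ab → settle (inj₁ (ab , c))) (forced₂ (split c) sa sb)
  forced-× split join (inj₂ c̄) (inj₂ ā) _ = inj₂ (settle (inj₂ (absent ā ∘ proj₁ , c̄)))
  forced-× split join (inj₂ c̄) (inj₁ a) (inj₁ b) = inj₁ (join c̄ a (closed (there b) (here refl)))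
  forced-× split join (inj₂ c̄) (inj₁ a) (inj₂ b̄) = inj₂ (settle (inj₂ (absent b̄ ∘ proj₂ , c̄)))

  forced-⊎ : ∀ {u a b c v} →
    (On u c (bar v) → Closes (lf u a (bar v) ∷ lf u b (bar v) ∷ Γ) → Closes Γ) →
    (On u c v → On u a (bar v) → Closes (lf u b v ∷ Γ) → Closes Γ) →
    Settled u c v Γ → Settled u a v Γ → Settled u b v Γ → ClosesOr ((On u a v ⊎ On u b v) ⇔ On u c v)
  forced-⊎ split join (inj₁ c) (inj₁ a) _ = inj₂ (settle (inj₁ (inj₁ a , c)))
  forced-⊎ split join (inj₁ c) (inj₂ ā) (inj₁ b) = inj₂ (settle (inj₁ (inj₂ b , c)))
  forced-⊎ split join (inj₁ c) (inj₂ ā) (inj₂ b̄) = inj₁ (join c ā (closed (here refl) (there b̄)))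
  forced-⊎ split join (inj₂ c̄) (inj₁ a) _ = inj₁ (split c̄ (closed (there (there a)) (here refl)))
  forced-⊎ split join (inj₂ c̄) (inj₂ ā) (inj₁ b) =
    inj₁ (split c̄ (closed (there (there b)) (there (here refl))))
  forced-⊎ split join (inj₂ c̄) (inj₂ ā) (inj₂ b̄) = inj₂ (settle (inj₂ ([ absent ā , absent b̄ ]′ , c̄)))

  Classical : ℕ → Form → Val → Set
  Classical k a v = On k a v × On k a (negV (bar v))

  ▲T-classical : ∀ {u k a} → On u (tri a) 𝔱 → On u (tri a) 𝔣̄ → rel u k ∈ Γ → Decided k a Γ →
    ClosesOr (Classical k a 𝔱 ⊎ Classical k a 𝔱̄)
  ▲T-classical t f̄ e (inj₁ m , sf) = Sum.map₂ (λ m′ → inj₁ (m , m′)) (forced (r-▲T t f̄ e m) (Sum.swap sf))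
  ▲T-classical t f̄ e (inj₂ m̄ , sf) = Sum.map₂ (λ m′ → inj₂ (m̄ , m′)) (forced (r-▲T t f̄ e m̄) sf)

  ▲T-disagree : ∀ {u k₁ k₂ a v} → On u (tri a) 𝔱 → On u (tri a) 𝔣̄ → rel u k₁ ∈ Γ → rel u k₂ ∈ Γ →
    Classical k₁ a v → On k₂ a (bar v) → Closes Γ
  ▲T-disagree t f̄ e₁ e₂ (m , m′) m̄ = r-▲T′ t f̄ e₁ e₂ m m′ (closed (here refl) (there (there m̄)))

  -- Successors are the children in the label tree, not the rel atoms of Γ, which
  -- need not all be saturated.
  model : Model
  model = record
    { W = LabelTree
    ; R = λ t t′ → t′ ∈ children t
    ; v⁺ = λ p t → On (label t) (var p) 𝔱
    ; v⁻ = λ p t → On (label t) (var p) 𝔣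
    ; inhabited = node 0 [] }

  open Sem model
  open Signed model

  Truth : LabelTree → Form → Set
  Truth t ψ = (t ⊨⁺ ψ ⇔ On (label t) ψ 𝔱) × (t ⊨⁻ ψ ⇔ On (label t) ψ 𝔣)

  truth⇒sat : ∀ {t ψ} v → Truth t ψ → On (label t) ψ v → t ⊨ ψ ∶ v
  truth⇒sat 𝔱 (T⁺ , _) m = Equivalence.from T⁺ m
  truth⇒sat 𝔣 (_ , T⁻) m = Equivalence.from T⁻ m
  truth⇒sat 𝔱̄ (T⁺ , _) m̄ = absent m̄ ∘ Equivalence.to T⁺
  truth⇒sat 𝔣̄ (_ , T⁻) m̄ = absent m̄ ∘ Equivalence.to T⁻

  sat∈ : ∀ {cs a c} v → All (λ c → Truth c a) cs → c ∈ cs → On (label c) a v → c ⊨ a ∶ v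
  sat∈ v Ts c∈ = truth⇒sat v (All.lookup Ts c∈)

  sat₂∈ : ∀ {cs a v v′} → All (λ c → Truth c a) cs → All (λ c → On (label c) a v × On (label c) a v′) cs →
    ∀ {c} → c ∈ cs → c ⊨ a ∶ v × c ⊨ a ∶ v′
  sat₂∈ {v = v} {v′} Ts ms c∈ = Product.map (sat∈ v Ts c∈) (sat∈ v′ Ts c∈) (All.lookup ms c∈)

  child : ∀ {k cs} → k ∈ map label cs → ∃ λ c → c ∈ cs
  child k∈ = let c , c∈ , _ = ∈-map⁻ label k∈ in c , c∈

  truth-▲ : ∀ {u cs a} → All (λ c → rel u (label c) ∈ Γ) cs → All (λ c → Decided (label c) a Γ) cs →
    All (λ c → Truth c a) cs → ▲Witness u (map label cs) a Γ → ClosesOr (Truth (node u cs) (tri a))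
  truth-▲ {u} {cs} {a} es ds Ts (▲T t f̄) = do
    classical ← sequence⊎ (All.zipWith (uncurry (▲T-classical t f̄)) (es , ds))
    constant ← uniform classical λ x∈ y∈ p q →
      ▲T-disagree t f̄ (All.lookup es x∈) (All.lookup es y∈) p (proj₁ q)
    let sem⁺ , sem⁻ = ▲-constant {node u cs} {a} (Sum.map (sat₂∈ Ts) (sat₂∈ Ts) constant)
    pure (settle (inj₁ (sem⁺ , t)) , settle (inj₂ (sem⁻ , f̄)))
  truth-▲ {u} {cs} {a} es ds Ts (▲B t f k∈) = do
    both ← sequence⊎ (All.zipWith (λ (e , d) → forced₂ (r-▲B t f e) (proj₁ d) (proj₂ d)) (es , ds))
    let sem⁺ , sem⁻ = ▲-glutty {node u cs} {a} (sat₂∈ Ts both) (child k∈)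
    pure (settle (inj₁ (sem⁺ , t)) , settle (inj₁ (sem⁻ , f)))
  truth-▲ {u} {cs} {a} es ds Ts (▲N t̄ f̄ k∈) = do
    neither ← sequence⊎ (All.zipWith (λ (e , d) → forced₂ (r-▲N t̄ f̄ e) (Sum.swap (proj₁ d)) (Sum.swap (proj₂ d)))
                                     (es , ds))
    let sem⁺ , sem⁻ = ▲-gappy {node u cs} {a} (sat₂∈ Ts neither) (child k∈)
    pure (settle (inj₂ (sem⁺ , t̄)) , settle (inj₂ (sem⁻ , f̄)))
  truth-▲ {u} {cs} {a} es ds Ts (▲F t̄ f k₁∈ k₂∈ d) with ∈-map⁻ label k₁∈ | ∈-map⁻ label k₂∈
  ... | c₁ , c₁∈ , refl | c₂ , c₂∈ , refl =
    let sem⁺ , sem⁻ = ▲-varying {node u cs} {a = a} c₁∈ c₂∈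
          (Sum.map (Product.map (sat∈ 𝔱 Ts c₁∈) (sat∈ 𝔱̄ Ts c₂∈)) (Product.map (sat∈ 𝔣 Ts c₁∈) (sat∈ 𝔣̄ Ts c₂∈)) d)
    in pure (settle (inj₂ (sem⁺ , t̄)) , settle (inj₁ (sem⁻ , f)))

root : Form × Val → Item
root (ψ , v) = lf 0 ψ v

Satisfies : (M : Model) → Model.W M → List (Form × Val) → Set
Satisfies M w = All λ (ψ , v) → w ⊨ ψ ∶ v
  where open Signed M

module Completeness (Γ₀ : List (Form × Val)) where

  InClosure : Form → Set
  InClosure ψ = Any ((ψ ≼_) ∘ proj₁) Γ₀

  InClosure-≼ : ∀ {a ψ} → a ≼ ψ → InClosure ψ → InClosure a
  InClosure-≼ a≼ψ = Any.map (≼-trans a≼ψ)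

  closure : List Form
  closure = concatMap (subformulas ∘ proj₁) Γ₀

  ∈-closure⁺ : ∀ {ψ} → InClosure ψ → ψ ∈ closure
  ∈-closure⁺ = ∈-concatMap⁺ (subformulas ∘ proj₁) ∘ Any.map ∈-subformulas⁺

  ∈-closure⁻ : ∀ {ψ} → ψ ∈ closure → InClosure ψ
  ∈-closure⁻ = Any.map (λ {(θ , _)} → ∈-subformulas⁻ θ) ∘ ∈-concatMap⁻ (subformulas ∘ proj₁)

  depth : ℕ
  depth = max 0 (map (modalDepth ∘ proj₁) Γ₀)

  ≤depth : ∀ {θ v} → (θ , v) ∈ Γ₀ → modalDepth θ ≤ depth
  ≤depth = All.lookup (All.map⁻ (xs≤max 0 (map (modalDepth ∘ proj₁) Γ₀)))

  Rooted : Branch → Set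
  Rooted Γ = map root Γ₀ ⊆ Γ

  subOn : ∀ {Γ ψ} → Rooted Γ → InClosure ψ → SubOn ψ Γ
  subOn r i = let (θ , v) , θ∈ , ψ≼θ = find i in 0 , θ , v , r (∈-map⁺ root θ∈) , ψ≼θ

  DecidesAll : ℕ → Branch → Set
  DecidesAll u Δ = All (λ ψ → Decided u ψ Δ) closure

  Expanded : ℕ → List ℕ → Branch → Set
  Expanded u ks Δ = All (λ k → rel u k ∈ Δ) ks × All (λ ψ → Witness u ks ψ Δ) closure

  Saturated : ℕ → LabelTree → Branch → Set
  Saturated 0 (node u _) Δ = DecidesAll u Δ
  Saturated (suc n) (node u cs) Δ =
    DecidesAll u Δ × Expanded u (map label cs) Δ × All (λ c → Saturated n c Δ) cs

  DecidesAll-mono : ∀ {u} → Monotone (DecidesAll u)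
  DecidesAll-mono s = All.map (Decided-mono s)

  Saturated-mono : ∀ {n t} → Monotone (Saturated n t)
  Saturated-mono {0} {node _ _} s sat = DecidesAll-mono s sat
  Saturated-mono {suc n} {node _ _} s (sat , (es , ws) , gs) =
    DecidesAll-mono s sat , (All.map s es , All.map (Witness-mono s ⊆-refl) ws) ,
    All.map (Saturated-mono s) gs

  decidesAll : ∀ {n t Δ} → Saturated n t Δ → DecidesAll (label t) Δ
  decidesAll {0} {node _ _} sat = sat
  decidesAll {suc n} {node _ _} (sat , _) = sat

  decided : ∀ {n t ψ Δ} → Saturated n t Δ → InClosure ψ → Decided (label t) ψ Δ
  decided g i = All.lookup (decidesAll g) (∈-closure⁺ i)

  plant : ∀ {n Δ ks} → All (λ k → ∃ λ cs → Saturated n (node k cs) Δ) ks →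
    ∃ λ ts → map label ts ≡ ks × All (λ t → Saturated n t Δ) ts
  plant [] = [] , refl , []
  plant ((cs , g) ∷ rest) with plant rest
  ... | ts , refl , gs = node _ cs ∷ ts , refl , g ∷ gs

  module _ where
    open ⇝-Monad

    decideAll : ∀ {Γ u} → Rooted Γ → Occurs u Γ → Γ ⇝ DecidesAll u
    decideAll r oc = ⇝-all closure Decided-mono λ ψ∈ s →
      decide⇝ (subOn (⊆-trans r s) (∈-closure⁻ ψ∈)) (Occurs-mono s oc)

    grow : ∀ {Γ} n u → Rooted Γ → Occurs u Γ → Γ ⇝ λ Δ → ∃ λ cs → Saturated n (node u cs) Δ
    grow 0 u r oc = do
      (_ , sat) ← decideAll r oc
      pure ([] , sat)
    grow (suc n) u r oc = do
      (s₁ , sat) ← decideAll r oc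
      (s₂ , ks , es , ws) ← expandAll closure sat
      (s₃ , subtrees) ← ⇝-all ks (λ s (cs , g) → cs , Saturated-mono s g) λ k∈ s →
        grow n _ (⊆-trans r (⊆-trans s₁ (⊆-trans s₂ s))) (_ , s (All.lookup es k∈) , in-relʳ)
      let cs , labels , gs = plant subtrees
      pure ( cs , DecidesAll-mono (⊆-trans s₂ s₃) sat
           , subst (λ ks → Expanded u ks _) (sym labels) (All.map s₃ es , All.map (Witness-mono s₃ ⊆-refl) ws)
           , gs )

  module _ {Γ : Branch} (consistent : NoClash Γ) where
    open Consistent consistent

    truth : ∀ n t ψ → InClosure ψ → Saturated n t Γ → modalDepth ψ ≤ n → ClosesOr (Truth t ψ)
    truth n t (var p) i g h = pure (⇔-refl , ⇔-refl)
    truth n t (neg a) i g h = do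
      (a⁺ , a⁻) ← truth n t a ia g h
      n⁺ ← forced-⇔ r-neg r-neg (proj₁ (decided g i)) (proj₂ (decided g ia))
      n⁻ ← forced-⇔ r-neg r-neg (proj₂ (decided g i)) (proj₁ (decided g ia))
      pure (⇔-trans a⁻ n⁺ , ⇔-trans a⁺ n⁻)
      where ia = InClosure-≼ (≼-neg ≼-refl) i
    truth n t (a ∧' b) i g h = do
      (a⁺ , a⁻) ← truth n t a ia g (ℕ.m⊔n≤o⇒m≤o _ _ h)
      (b⁺ , b⁻) ← truth n t b ib g (ℕ.m⊔n≤o⇒n≤o _ _ h)
      c⁺ ← forced-× r-∧𝔱 (r-∧𝔱̄ pick₁) (proj₁ (decided g i)) (proj₁ (decided g ia)) (proj₁ (decided g ib))
      c⁻ ← forced-⊎ r-∧𝔣̄ (r-∧𝔣 pick₁) (proj₂ (decided g i)) (proj₂ (decided g ia)) (proj₂ (decided g ib))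
      pure (⇔-trans (a⁺ ×-⇔ b⁺) c⁺ , ⇔-trans (a⁻ ⊎-⇔ b⁻) c⁻)
      where ia = InClosure-≼ (≼-∧₁ ≼-refl) i
            ib = InClosure-≼ (≼-∧₂ ≼-refl) i
    truth n t (a ∨' b) i g h = do
      (a⁺ , a⁻) ← truth n t a ia g (ℕ.m⊔n≤o⇒m≤o _ _ h)
      (b⁺ , b⁻) ← truth n t b ib g (ℕ.m⊔n≤o⇒n≤o _ _ h)
      d⁺ ← forced-⊎ r-∨𝔱̄ (r-∨𝔱 pick₁) (proj₁ (decided g i)) (proj₁ (decided g ia)) (proj₁ (decided g ib))
      d⁻ ← forced-× r-∨𝔣 (r-∨𝔣̄ pick₁) (proj₂ (decided g i)) (proj₂ (decided g ia)) (proj₂ (decided g ib))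
      pure (⇔-trans (a⁺ ⊎-⇔ b⁺) d⁺ , ⇔-trans (a⁻ ×-⇔ b⁻) d⁻)
      where ia = InClosure-≼ (≼-∨₁ ≼-refl) i
            ib = InClosure-≼ (≼-∨₂ ≼-refl) i
    truth 0 (node u cs) (tri a) i g ()
    truth (suc n) (node u cs) (tri a) i (sat , (es , ws) , gs) (s≤s h) = do
      Ts ← sequence⊎ (All.map (λ {c} g → truth n c a ia g h) gs)
      truth-▲ (All.map⁻ es) (All.map (λ g → decided g ia) gs) Ts (All.lookup ws (∈-closure⁺ i) refl)
      where ia = InClosure-≼ (≼-tri ≼-refl) i

    root-satisfies : ∀ {cs} → Rooted Γ → Saturated depth (node 0 cs) Γ →
      ClosesOr (Satisfies model (node 0 cs) Γ₀)
    root-satisfies r g = sequence⊎ (All.tabulate λ {(θ , v)} θ∈ →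
      Sum.map₂ (λ T → truth⇒sat v T (r (∈-map⁺ root θ∈))) (truth depth _ θ (lose θ∈ ≼-refl) g (≤depth θ∈)))

  leaf-closes : (∀ M w → ¬ Satisfies M w Γ₀) →
    ∀ {Δ} → Rooted Δ → ∃ (λ cs → Saturated depth (node 0 cs) Δ) → Closes Δ
  leaf-closes unsat {Δ} r (cs , g) with clash? Δ
  ... | inj₁ closes = closes
  ... | inj₂ consistent =
    [ id , ⊥-elim ∘ unsat (Consistent.model consistent) (node 0 cs) ]′ (root-satisfies consistent r g)

completeness : ∀ Γ₀ → (∀ M w → ¬ Satisfies M w Γ₀) → Closes (map root Γ₀)
-- Label 0 does not occur on the empty branch, so no cut applies there; but every model
-- satisfies it.
completeness [] unsat = ⊥-elim (unsat (Consistent.model {[]} λ ()) (node 0 []) [])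
completeness Γ₀@((θ , v) ∷ _) unsat = grow depth 0 ⊆-refl (lf 0 θ v , here refl , in-lf) (leaf-closes unsat)
  where open Completeness Γ₀

theorem3 : (φ χ : Form) → Valid φ χ → Provable φ χ
theorem3 φ χ valid = completeness ((φ , 𝔱) ∷ (χ , 𝔱̄) ∷ []) λ { M w (⊨φ ∷ ⊭χ ∷ []) → ⊭χ (valid M w ⊨φ) }
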